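{- Let $d\ge0$ and $m=2^d$. A binary word is a $(1,m)$-nested perfect necklace if and only if it is of the form $ww'$ where $w,w'$ are binary words of length $m$ with $w'=w\oplus 1^m$. Furthermore, every $(1,m)$-nested perfect necklace is a $(1,m)$-affine necklace.
   Context: Words are over $\mathbb{F}_2=\{0,1\}$; positions numbered from $1$; a word $a_1\cdots a_n$ is identified with the column vector $(a_1,\dots,a_n)^t$; $\oplus$ is componentwise addition mod $2$; $1^m$ is the word of $m$ ones. For a word $v$ of length $L$, a symbol occurs cyclically at position $j$ as usual (factor of $vv$). A binary word $v$ of length $2m$ is a $(1,m)$-perfect necklace if each symbol $a\in\{0,1\}$ occurs in $v$ exactly $m$ times, at positions pairwise incongruent modulo $m$; a $(1,m)$-nested perfect necklace is the same as a $(1,m)$-perfect necklace (the only block to check is the whole word). Matrices: $M_0=(1)$, $M_{d+1}=\begin{pmatrix}M_d&M_d\\0&M_d\end{pmatrix}$ over $\mathbb{F}_2$. Let $\sigma$ map $a_1\cdots a_n$ to $a_na_1\cdots a_{n-1}$ (also on column vectors). For integers $n_1,\dots,n_m$ with $n_m=0$ and $n_{i+1}\le n_i\le n_{i+1}+1$ ($1\le i<m$), and $C_1,\dots,C_m$ the columns of $M_d$, set $M_d^{n_1,\dots,n_m}=(\sigma^{n_1}(C_1),\dots,\sigma^{n_m}(C_m))$. Let $w_1,\dots,w_{2^m}$ be all binary words of length $m$ in lexicographic order. A $(k,m)$-affine necklace ($1\le k\le m$) is a word $(Mw'_1)(Mw'_2)\cdots(Mw'_{2^k})$ where $M$ is some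 $M_d^{n_1,\dots,n_m}$, $z$ is a binary word of length $m$, and $w'_i=w_i\oplus z$. -}

module Defs where

open import Data.Bool using (Bool; true; false; not; _xor_; if_then_else_)
open import Data.Bool.Properties using () renaming (_≟_ to _≟ᵇ_)
open import Data.Nat using (ℕ; zero; suc; _+_; _∸_; _^_; _≤_; _<ᵇ_; ∣_-_∣)
open import Data.Nat.Divisibility using (_∣_)
open import Data.List using (List; []; _∷_; _++_; length; lookup; filter; zipWith;
  replicate; map; take; drop; foldr; concatMap; upTo)
open import Data.Fin using (Fin; toℕ)
open import Data.Product using (_×_; Σ; ∃; _,_)
open import Data.Unit using (⊤)
open import Data.Empty using (⊥)
open import Relation.Binary.PropositionalEquality using (_≡_; _≢_)
open import Relation.Nullary using (¬_)

-- Binary words over F₂ = Bool (false = 0, true = 1), as lists.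
Word : Set
Word = List Bool

_⊕_ : Word → Word → Word
_⊕_ = zipWith _xor_

ones : ℕ → Word
ones m = replicate m true

-- Positions are 0-indexed here (Fin (length v)); congruence mod m is
-- insensitive to the shift by 1.  For k = 1 a cyclic occurrence of a
-- single symbol at position j is just the letter at position j.

CongMod : ℕ → ℕ → ℕ → Set
CongMod m i j = m ∣ ∣ i - j ∣

PerfectNecklace1 : ℕ → Word → Set
PerfectNecklace1 m v =
  length v ≡ m + m ×
  ((a : Bool) →
     length (filter (_≟ᵇ a) v) ≡ m ×
     ((i j : Fin (length v)) → lookup v i ≡ a → lookup v j ≡ a → i ≢ j →
        ¬ CongMod m (toℕ i) (toℕ j)))

-- For k = 1 the only block to check is the whole word, so a
-- (1,m)-nested perfect necklace is a (1,m)-perfect necklace.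
NestedPerfectNecklace1 : ℕ → Word → Set
NestedPerfectNecklace1 = PerfectNecklace1

-- The matrices M_d, entries indexed from 0: (row i, column j), i,j < 2^d.
-- M_0 = (1),  M_{d+1} = [[M_d, M_d], [0, M_d]].

Ment : ℕ → ℕ → ℕ → Bool
Ment zero    i j = true
Ment (suc d) i j =
  if i <ᵇ 2 ^ d
    then (if j <ᵇ 2 ^ d then Ment d i j else Ment d i (j ∸ 2 ^ d))
    else (if j <ᵇ 2 ^ d then false else Ment d (i ∸ 2 ^ d) (j ∸ 2 ^ d))

columns : ℕ → List Word
columns d = map (λ j → map (λ i → Ment d i j) (upTo (2 ^ d))) (upTo (2 ^ d))

σ : Word → Word
σ xs = drop (length xs ∸ 1) xs ++ take (length xs ∸ 1) xs

σ^ : ℕ → Word → Word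
σ^ zero    xs = xs
σ^ (suc n) xs = σ (σ^ n xs)

-- M_d^{n₁,…,n_m} as its list of columns (σ^{n_j}(C_j))_j
Mshift : ℕ → List ℕ → List Word
Mshift d ns = zipWith σ^ ns (columns d)

Admissible : List ℕ → Set
Admissible []            = ⊥
Admissible (x ∷ [])      = x ≡ 0
Admissible (x ∷ y ∷ r)   = (y ≤ x × x ≤ y + 1) × Admissible (y ∷ r)

-- matrix (given by its columns, of height m) times column vector over F₂
mulMV : ℕ → List Word → Word → Word
mulMV m cols w = foldr step (replicate m false) (zipWith _,_ cols w)
  where
  step : Σ Word (λ _ → Bool) → Word → Word
  step (c , b) acc = if b then c ⊕ acc else acc

-- all binary words of length m in lexicographic order
allWords : ℕ → List Word
allWords zero    = [] ∷ []
allWords (suc m) = map (false ∷_) (allWords m) ++ map (true ∷_) (allWords m)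

AffineNecklace : ℕ → ℕ → Word → Set
AffineNecklace d k v =
  ∃ λ (ns : List ℕ) → length ns ≡ 2 ^ d × Admissible ns ×
  ∃ λ (z : Word) → length z ≡ 2 ^ d ×
  v ≡ concatMap (λ w → mulMV (2 ^ d) (Mshift d ns) (w ⊕ z)) (take (2 ^ k) (allWords (2 ^ d)))

{-# OPTIONS --safe #-}
module Submission where

-- In a word of length 2m the only pairs of distinct positions congruent mod m are {r, m + r},
-- so being a (1,m)-perfect necklace says exactly that the second half complements the first.
-- For the affine form take every shift n_i = 0, i.e. M = M_d. Block-wise,
-- M_{d+1} (z₁ z₂) = (M_d z₁ ⊕ M_d z₂) (M_d z₂), so M_d is onto and w = M_d z for some z.
-- The first two words of length m are 0^m and 0^{m-1}1, and M_d sends the latter to its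
-- last column 1^m; by linearity the affine necklace is (M_d z) (M_d z ⊕ 1^m) = w (w ⊕ 1^m).

open import Defs
open import Data.Nat using (ℕ; _^_)
open import Data.Bool using (Bool)
open import Data.List using (List; length; _++_)
open import Data.Product using (_×_; ∃)
open import Relation.Binary.PropositionalEquality using (_≡_)
open import Function.Bundles using (_⇔_)

open import Data.Bool using (true; false; not; _xor_; if_then_else_)
open import Data.Bool.Properties using (xor-assoc; xor-comm; xor-same; not-¬; ¬-not)
  renaming (_≟_ to _≟ᵇ_)
open import Data.Nat using (zero; suc; _+_; _*_; _∸_; _<_; _≤_; _<ᵇ_; _⊓_; z≤n; s≤s; ∣_-_∣)
open import Data.Nat.Properties
open import Data.Nat.Divisibility using (_∣_; divides; ∣-refl)
open import Data.List
  using ([]; _∷_; replicate; map; applyUpTo; upTo; zipWith; filter; take; drop; lookup; concatMap)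
open import Data.List.Properties
  using (length-++; length-zipWith; length-replicate; length-applyUpTo; map-applyUpTo; map-++; map-id;
         length-map; length-take; length-drop; take++drop≡id; ++-assoc; ++-identityʳ; zipWith-comm; filter-++)
open import Data.List.Relation.Unary.All using (All; []; _∷_; universal)
open import Data.List.Relation.Unary.All.Properties using (map⁺)
open import Data.Product using (_,_; proj₂)
open import Data.Sum using (inj₁; inj₂)
open import Data.Empty using (⊥; ⊥-elim)
open import Data.Fin using (Fin; toℕ; fromℕ<)
open import Data.Fin.Properties using (toℕ-fromℕ<; toℕ-injective; toℕ<n)
open import Relation.Binary.PropositionalEquality
  using (refl; sym; trans; cong; cong₂; subst; _≢_; module ≡-Reasoning)
open import Function using (_∘_; id)
open import Function.Bundles using (mk⇔)

open ≡-Reasoning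

replicate-+ : ∀ {A : Set} m n (x : A) → replicate (m + n) x ≡ replicate m x ++ replicate n x
replicate-+ zero    n x = refl
replicate-+ (suc m) n x = cong (x ∷_) (replicate-+ m n x)

length-∷ʳ : ∀ {A : Set} (xs : List A) x → length (xs ++ x ∷ []) ≡ suc (length xs)
length-∷ʳ []       x = refl
length-∷ʳ (y ∷ xs) x = cong suc (length-∷ʳ xs x)

halves : ∀ {A : Set} n (xs : List A) → length xs ≡ n + n →
  ∃ λ ys → ∃ λ zs → length ys ≡ n × length zs ≡ n × xs ≡ ys ++ zs
halves n xs |xs|≡n+n = take n xs , drop n xs ,
  trans (length-take n xs) (trans (cong (n ⊓_) |xs|≡n+n) (m≤n⇒m⊓n≡m (m≤m+n n n))) ,
  trans (length-drop n xs) (trans (cong (_∸ n) |xs|≡n+n) (m+n∸m≡n n n)) ,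
  sym (take++drop≡id n xs)

applyUpTo-cong< : ∀ {A : Set} (f g : ℕ → A) n → (∀ i → i < n → f i ≡ g i) → applyUpTo f n ≡ applyUpTo g n
applyUpTo-cong< f g zero    f≗g = refl
applyUpTo-cong< f g (suc n) f≗g =
  cong₂ _∷_ (f≗g 0 (s≤s z≤n)) (applyUpTo-cong< (f ∘ suc) (g ∘ suc) n (λ i i<n → f≗g (suc i) (s≤s i<n)))

applyUpTo-+ : ∀ {A : Set} (f : ℕ → A) m n →
  applyUpTo f (m + n) ≡ applyUpTo f m ++ applyUpTo (λ i → f (m + i)) n
applyUpTo-+ f zero    n = refl
applyUpTo-+ f (suc m) n = cong (f 0 ∷_) (applyUpTo-+ (f ∘ suc) m n)

applyUpTo-const : ∀ {A : Set} (x : A) n → applyUpTo (λ _ → x) n ≡ replicate n x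
applyUpTo-const x zero    = refl
applyUpTo-const x (suc n) = cong (x ∷_) (applyUpTo-const x n)

zeros : ℕ → Word
zeros n = replicate n false

length-⊕ : ∀ x y → length (x ⊕ y) ≡ length x ⊓ length y
length-⊕ = length-zipWith _xor_

length-⊕≤ˡ : ∀ x y → length (x ⊕ y) ≤ length x
length-⊕≤ˡ x y = ≤-trans (≤-reflexive (length-⊕ x y)) (m⊓n≤m (length x) (length y))

length-⊕-≡ : ∀ {m} x y → length x ≡ m → length y ≡ m → length (x ⊕ y) ≡ m
length-⊕-≡ {m} x y |x|≡m |y|≡m = trans (length-⊕ x y) (trans (cong₂ _⊓_ |x|≡m |y|≡m) (⊓-idem m))

length-⊕-ones : ∀ {m} w → length w ≡ m → length (w ⊕ ones m) ≡ m
length-⊕-ones {m} w |w|≡m = length-⊕-≡ w (ones m) |w|≡m (length-replicate m)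

⊕-comm : ∀ x y → x ⊕ y ≡ y ⊕ x
⊕-comm = zipWith-comm _xor_ xor-comm

⊕-assoc : ∀ x y z → (x ⊕ y) ⊕ z ≡ x ⊕ (y ⊕ z)
⊕-assoc []      y       z       = refl
⊕-assoc (a ∷ x) []      z       = refl
⊕-assoc (a ∷ x) (b ∷ y) []      = refl
⊕-assoc (a ∷ x) (b ∷ y) (c ∷ z) = cong₂ _∷_ (xor-assoc a b c) (⊕-assoc x y z)

⊕-left-comm : ∀ x y z → x ⊕ (y ⊕ z) ≡ y ⊕ (x ⊕ z)
⊕-left-comm x y z = begin
  x ⊕ (y ⊕ z) ≡⟨ ⊕-assoc x y z ⟨
  (x ⊕ y) ⊕ z ≡⟨ cong (_⊕ z) (⊕-comm x y) ⟩
  (y ⊕ x) ⊕ z ≡⟨ ⊕-assoc y x z ⟩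
  y ⊕ (x ⊕ z) ∎

⊕-self : ∀ x → x ⊕ x ≡ zeros (length x)
⊕-self []      = refl
⊕-self (a ∷ x) = cong₂ _∷_ (xor-same a) (⊕-self x)

zeros-⊕ : ∀ n y → length y ≤ n → zeros n ⊕ y ≡ y
zeros-⊕ zero    []      _         = refl
zeros-⊕ (suc n) []      _         = refl
zeros-⊕ (suc n) (b ∷ y) (s≤s |y|≤n) = cong (b ∷_) (zeros-⊕ n y |y|≤n)

zeros-⊕-zeros : ∀ n → zeros n ⊕ zeros n ≡ zeros n
zeros-⊕-zeros n = zeros-⊕ n (zeros n) (≤-reflexive (length-replicate n))

⊕-zeros : ∀ n y → length y ≤ n → y ⊕ zeros n ≡ y
⊕-zeros n y |y|≤n = trans (⊕-comm y (zeros n)) (zeros-⊕ n y |y|≤n)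

⊕-cancelʳ : ∀ x y → length x ≤ length y → (x ⊕ y) ⊕ y ≡ x
⊕-cancelʳ x y |x|≤|y| = begin
  (x ⊕ y) ⊕ y         ≡⟨ ⊕-assoc x y y ⟩
  x ⊕ (y ⊕ y)         ≡⟨ cong (x ⊕_) (⊕-self y) ⟩
  x ⊕ zeros (length y) ≡⟨ ⊕-zeros (length y) x |x|≤|y| ⟩
  x                   ∎

⊕-++ : ∀ x₁ x₂ y₁ y₂ → length x₁ ≡ length y₁ → (x₁ ++ x₂) ⊕ (y₁ ++ y₂) ≡ (x₁ ⊕ y₁) ++ (x₂ ⊕ y₂)
⊕-++ []       x₂ []       y₂ _ = refl
⊕-++ (a ∷ x₁) x₂ (b ∷ y₁) y₂ e = cong ((a xor b) ∷_) (⊕-++ x₁ x₂ y₁ y₂ (suc-injective e))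

nth : Word → ℕ → Bool
nth []       _       = false
nth (x ∷ xs) zero    = x
nth (x ∷ xs) (suc k) = nth xs k

lookup≡nth : ∀ xs (i : Fin (length xs)) → lookup xs i ≡ nth xs (toℕ i)
lookup≡nth (x ∷ xs) Fin.zero    = refl
lookup≡nth (x ∷ xs) (Fin.suc i) = lookup≡nth xs i

≡-by-nth : ∀ xs ys → length xs ≡ length ys → (∀ k → k < length xs → nth xs k ≡ nth ys k) → xs ≡ ys
≡-by-nth []       []       _ _ = refl
≡-by-nth (x ∷ xs) (y ∷ ys) e h =
  cong₂ _∷_ (h 0 (s≤s z≤n)) (≡-by-nth xs ys (suc-injective e) (λ k k< → h (suc k) (s≤s k<)))

nth-++ˡ : ∀ w u k → k < length w → nth (w ++ u) k ≡ nth w k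
nth-++ˡ (x ∷ w) u zero    _        = refl
nth-++ˡ (x ∷ w) u (suc k) (s≤s k<) = nth-++ˡ w u k k<

nth-++ʳ : ∀ w u k → nth (w ++ u) (length w + k) ≡ nth u k
nth-++ʳ []      u k = refl
nth-++ʳ (x ∷ w) u k = nth-++ʳ w u k

nth-⊕-ones : ∀ w n k → k < length w → k < n → nth (w ⊕ ones n) k ≡ not (nth w k)
nth-⊕-ones (true  ∷ w) (suc n) zero    _          _          = refl
nth-⊕-ones (false ∷ w) (suc n) zero    _          _          = refl
nth-⊕-ones (x ∷ w)     (suc n) (suc k) (s≤s k<w) (s≤s k<n) = nth-⊕-ones w n k k<w k<n

m∣n∧0<n<m+m⇒n≡m : ∀ m n → 0 < n → n < m + m → m ∣ n → n ≡ m
m∣n∧0<n<m+m⇒n≡m m n 0<n _       (divides zero          n≡0)    = ⊥-elim (<⇒≢ 0<n (sym n≡0))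
m∣n∧0<n<m+m⇒n≡m m n _   _       (divides (suc zero)    n≡1*m)  = trans n≡1*m (+-identityʳ m)
m∣n∧0<n<m+m⇒n≡m m n _   n<m+m   (divides (suc (suc q)) n≡qm) =
  ⊥-elim (<⇒≱ n<m+m (subst (m + m ≤_) (sym n≡qm) (+-monoʳ-≤ m (m≤m+n m (q * m)))))

perfect⇒antipodes-differ : ∀ {m r} v → PerfectNecklace1 m v → r < m → nth v (m + r) ≢ nth v r
perfect⇒antipodes-differ {m} {r} v (|v|≡m+m , perfect) r<m same =
  proj₂ (perfect (nth v r)) i j letter-i letter-j i≢j congruent
  where
  r<|v| : r < length v
  r<|v| = subst (r <_) (sym |v|≡m+m) (<-≤-trans r<m (m≤m+n m m))
  m+r<|v| : m + r < length v
  m+r<|v| = subst (m + r <_) (sym |v|≡m+m) (+-monoʳ-< m r<m)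
  i j : Fin (length v)
  i = fromℕ< r<|v|
  j = fromℕ< m+r<|v|
  letter-i : lookup v i ≡ nth v r
  letter-i = trans (lookup≡nth v i) (cong (nth v) (toℕ-fromℕ< r<|v|))
  letter-j : lookup v j ≡ nth v r
  letter-j = trans (lookup≡nth v j) (trans (cong (nth v) (toℕ-fromℕ< m+r<|v|)) same)
  i≢j : i ≢ j
  i≢j i≡j = <⇒≢ (m<n+m r (<-≤-trans (s≤s z≤n) r<m))
    (trans (sym (toℕ-fromℕ< r<|v|)) (trans (cong toℕ i≡j) (toℕ-fromℕ< m+r<|v|)))
  congruent : CongMod m (toℕ i) (toℕ j)
  congruent = subst (m ∣_) (sym (begin
    ∣ toℕ i - toℕ j ∣ ≡⟨ cong₂ ∣_-_∣ (toℕ-fromℕ< r<|v|) (toℕ-fromℕ< m+r<|v|) ⟩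
    ∣ r - m + r ∣     ≡⟨ cong (∣ r -_∣) (+-comm m r) ⟩
    ∣ r - r + m ∣     ≡⟨ ∣m-m+n∣≡n r m ⟩
    m                 ∎)) ∣-refl

complementary-if-antipodes-differ : ∀ {m} w u → length w ≡ m → length u ≡ m →
  (∀ r → r < m → nth (w ++ u) (m + r) ≢ nth (w ++ u) r) → u ≡ w ⊕ ones m
complementary-if-antipodes-differ w u refl |u|≡|w| differ =
  ≡-by-nth u (w ⊕ ones (length w)) (trans |u|≡|w| (sym (length-⊕-ones w refl))) λ k k<|u| →
    let k<|w| = subst (k <_) |u|≡|w| k<|u| in begin
      nth u k                       ≡⟨ ¬-not (λ eq → differ k k<|w|
                                           (trans (nth-++ʳ w u k) (trans eq (sym (nth-++ˡ w u k k<|w|))))) ⟩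
      not (nth w k)                 ≡⟨ nth-⊕-ones w (length w) k k<|w| k<|w| ⟨
      nth (w ⊕ ones (length w)) k   ∎

perfect⇒complementary-halves : ∀ {m} v → PerfectNecklace1 m v →
  ∃ λ w → length w ≡ m × v ≡ w ++ (w ⊕ ones m)
perfect⇒complementary-halves {m} v P@(|v|≡m+m , _) with halves m v |v|≡m+m
... | w , u , |w|≡m , |u|≡m , refl =
  w , |w|≡m , cong (w ++_) (complementary-if-antipodes-differ w u |w|≡m |u|≡m
                              (λ r r<m → perfect⇒antipodes-differ (w ++ u) P r<m))

count-complementary : ∀ a w →
  length (filter (_≟ᵇ a) w) + length (filter (_≟ᵇ a) (w ⊕ ones (length w))) ≡ length w
count-complementary a     []          = refl
count-complementary true  (true  ∷ w) = cong suc (count-complementary true w)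
count-complementary false (false ∷ w) = cong suc (count-complementary false w)
count-complementary true  (false ∷ w) = trans (+-suc _ _) (cong suc (count-complementary true w))
count-complementary false (true  ∷ w) = trans (+-suc _ _) (cong suc (count-complementary false w))

complementary-halves-perfect : ∀ {m} w → length w ≡ m → PerfectNecklace1 m (w ++ (w ⊕ ones m))
complementary-halves-perfect {m} w refl = |v|≡m+m , λ a → count a , incongruent a
  where
  v = w ++ (w ⊕ ones m)
  |v|≡m+m : length v ≡ m + m
  |v|≡m+m = trans (length-++ w) (cong (m +_) (length-⊕-ones w refl))
  count : ∀ a → length (filter (_≟ᵇ a) v) ≡ m
  count a = begin
    length (filter (_≟ᵇ a) v)
      ≡⟨ cong length (filter-++ (_≟ᵇ a) w (w ⊕ ones m)) ⟩
    length (filter (_≟ᵇ a) w ++ filter (_≟ᵇ a) (w ⊕ ones m))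
      ≡⟨ length-++ (filter (_≟ᵇ a) w) ⟩
    length (filter (_≟ᵇ a) w) + length (filter (_≟ᵇ a) (w ⊕ ones m))
      ≡⟨ count-complementary a w ⟩
    m ∎
  congruent-letters-differ : ∀ {x y} → x ≤ y → y < m + m → x ≢ y → m ∣ ∣ x - y ∣ → nth v x ≢ nth v y
  congruent-letters-differ {x} {y} x≤y y<m+m x≢y m∣y-x same = not-¬ refl (begin
    nth w x                 ≡⟨ nth-++ˡ w _ x x<m ⟨
    nth v x                 ≡⟨ same ⟩
    nth v y                 ≡⟨ cong (nth v) m+x≡y ⟨
    nth v (m + x)           ≡⟨ nth-++ʳ w _ x ⟩
    nth (w ⊕ ones m) x      ≡⟨ nth-⊕-ones w m x x<m x<m ⟩
    not (nth w x)           ∎)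
    where
    y∸x≡m : y ∸ x ≡ m
    y∸x≡m = m∣n∧0<n<m+m⇒n≡m m (y ∸ x) (m<n⇒0<n∸m (≤∧≢⇒< x≤y x≢y)) (≤-<-trans (m∸n≤m y x) y<m+m)
      (subst (m ∣_) (m≤n⇒∣m-n∣≡n∸m x≤y) m∣y-x)
    m+x≡y : m + x ≡ y
    m+x≡y = trans (cong (_+ x) (sym y∸x≡m)) (m∸n+n≡m x≤y)
    x<m : x < m
    x<m = +-cancelˡ-< m x m (subst (_< m + m) (sym m+x≡y) y<m+m)
  incongruent : ∀ a (i j : Fin (length v)) → lookup v i ≡ a → lookup v j ≡ a → i ≢ j →
    CongMod m (toℕ i) (toℕ j) → ⊥
  incongruent a i j vi≡a vj≡a i≢j m∣i-j with ≤-total (toℕ i) (toℕ j)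
  ... | inj₁ i≤j = congruent-letters-differ i≤j (subst (toℕ j <_) |v|≡m+m (toℕ<n j))
    (i≢j ∘ toℕ-injective) m∣i-j
    (trans (sym (lookup≡nth v i)) (trans vi≡a (trans (sym vj≡a) (lookup≡nth v j))))
  ... | inj₂ j≤i = congruent-letters-differ j≤i (subst (toℕ i <_) |v|≡m+m (toℕ<n i))
    (i≢j ∘ sym ∘ toℕ-injective)
    (subst (m ∣_) (∣-∣-comm (toℕ i) (toℕ j)) m∣i-j)
    (trans (sym (lookup≡nth v j)) (trans vj≡a (trans (sym vi≡a) (lookup≡nth v i))))

ComplementaryHalves : ℕ → Word → Set
ComplementaryHalves m v =
  ∃ λ w → ∃ λ w' → length w ≡ m × length w' ≡ m × w' ≡ w ⊕ ones m × v ≡ w ++ w'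

perfect⇔complementary-halves : ∀ {m} v → PerfectNecklace1 m v ⇔ ComplementaryHalves m v
perfect⇔complementary-halves {m} v = mk⇔ split join
  where
  split : PerfectNecklace1 m v → ComplementaryHalves m v
  split P with perfect⇒complementary-halves v P
  ... | w , |w|≡m , v≡ = w , w ⊕ ones m , |w|≡m , length-⊕-ones w |w|≡m , refl , v≡
  join : ComplementaryHalves m v → PerfectNecklace1 m v
  join (w , _ , |w|≡m , _ , refl , refl) = complementary-halves-perfect w |w|≡m

ColumnsOfHeight : ℕ → List Word → Set
ColumnsOfHeight m = All (λ c → length c ≡ m)

length-mulMV≤ : ∀ m cs z → length (mulMV m cs z) ≤ m
length-mulMV≤ m []       z           = ≤-reflexive (length-replicate m)
length-mulMV≤ m (c ∷ cs) []          = ≤-reflexive (length-replicate m)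
length-mulMV≤ m (c ∷ cs) (false ∷ z) = length-mulMV≤ m cs z
length-mulMV≤ m (c ∷ cs) (true  ∷ z) =
  ≤-trans (≤-reflexive (length-⊕ c _)) (≤-trans (m⊓n≤n (length c) _) (length-mulMV≤ m cs z))

length-mulMV : ∀ {m cs} z → ColumnsOfHeight m cs → length (mulMV m cs z) ≡ m
length-mulMV {m} {[]}     z           _            = length-replicate m
length-mulMV {m} {c ∷ cs} []          _            = length-replicate m
length-mulMV {m} {c ∷ cs} (false ∷ z) (_ ∷ hs)     = length-mulMV z hs
length-mulMV {m} {c ∷ cs} (true  ∷ z) (|c|≡m ∷ hs) =
  trans (length-⊕ c _) (trans (cong₂ _⊓_ |c|≡m (length-mulMV z hs)) (⊓-idem m))

mulMV-zeros : ∀ m cs n → mulMV m cs (zeros n) ≡ zeros m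
mulMV-zeros m []       n       = refl
mulMV-zeros m (c ∷ cs) zero    = refl
mulMV-zeros m (c ∷ cs) (suc n) = mulMV-zeros m cs n

mulMV-++ : ∀ m cs₁ cs₂ z₁ z₂ → length cs₁ ≡ length z₁ →
  mulMV m (cs₁ ++ cs₂) (z₁ ++ z₂) ≡ mulMV m cs₁ z₁ ⊕ mulMV m cs₂ z₂
mulMV-++ m []        cs₂ []           z₂ _ = sym (zeros-⊕ m _ (length-mulMV≤ m cs₂ z₂))
mulMV-++ m (c ∷ cs₁) cs₂ (false ∷ z₁) z₂ e = mulMV-++ m cs₁ cs₂ z₁ z₂ (suc-injective e)
mulMV-++ m (c ∷ cs₁) cs₂ (true  ∷ z₁) z₂ e =
  trans (cong (c ⊕_) (mulMV-++ m cs₁ cs₂ z₁ z₂ (suc-injective e))) (sym (⊕-assoc c _ _))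

mulMV-last-unit : ∀ {m k} cs c → length cs ≡ k → length c ≤ m →
  mulMV m (cs ++ c ∷ []) (zeros k ++ true ∷ []) ≡ c
mulMV-last-unit {m} {k} cs c |cs|≡k |c|≤m = begin
  mulMV m (cs ++ c ∷ []) (zeros k ++ true ∷ [])
    ≡⟨ mulMV-++ m cs (c ∷ []) (zeros k) (true ∷ []) (trans |cs|≡k (sym (length-replicate k))) ⟩
  mulMV m cs (zeros k) ⊕ (c ⊕ zeros m)
    ≡⟨ cong₂ _⊕_ (mulMV-zeros m cs k) (⊕-zeros m c |c|≤m) ⟩
  zeros m ⊕ c
    ≡⟨ zeros-⊕ m c |c|≤m ⟩
  c ∎

mulMV-⊕ : ∀ {m} cs x y → ColumnsOfHeight m cs → length x ≡ length y →
  mulMV m cs (x ⊕ y) ≡ mulMV m cs x ⊕ mulMV m cs y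
mulMV-⊕ {m} []       x       y       _            _ = sym (zeros-⊕-zeros m)
mulMV-⊕ {m} (c ∷ cs) []      []      _            _ = sym (zeros-⊕-zeros m)
mulMV-⊕ {m} (c ∷ cs) (a ∷ x) (b ∷ y) (|c|≡m ∷ hs) e =
  trans (cong (λ s → if a xor b then c ⊕ s else s) (mulMV-⊕ cs x y hs (suc-injective e))) (by-cases a b)
  where
  X = mulMV m cs x
  Y = mulMV m cs y
  by-cases : ∀ a b → (if a xor b then c ⊕ (X ⊕ Y) else X ⊕ Y)
                   ≡ (if a then c ⊕ X else X) ⊕ (if b then c ⊕ Y else Y)
  by-cases false false = refl
  by-cases false true  = ⊕-left-comm c X Y
  by-cases true  false = sym (⊕-assoc c X Y)
  by-cases true  true  = sym (begin
    (c ⊕ X) ⊕ (c ⊕ Y)    ≡⟨ ⊕-assoc c X (c ⊕ Y) ⟩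
    c ⊕ (X ⊕ (c ⊕ Y))    ≡⟨ cong (c ⊕_) (⊕-left-comm X c Y) ⟩
    c ⊕ (c ⊕ (X ⊕ Y))    ≡⟨ ⊕-assoc c c (X ⊕ Y) ⟨
    (c ⊕ c) ⊕ (X ⊕ Y)    ≡⟨ cong (_⊕ (X ⊕ Y)) (trans (⊕-self c) (cong zeros |c|≡m)) ⟩
    zeros m ⊕ (X ⊕ Y)    ≡⟨ zeros-⊕ m (X ⊕ Y) (≤-trans (length-⊕≤ˡ X Y) (length-mulMV≤ m cs x)) ⟩
    X ⊕ Y                ∎)

mulMV-zero-columns : ∀ m (cs : List Word) z → mulMV m (map (λ _ → zeros m) cs) z ≡ zeros m
mulMV-zero-columns m []       z           = refl
mulMV-zero-columns m (c ∷ cs) []          = refl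
mulMV-zero-columns m (c ∷ cs) (false ∷ z) = mulMV-zero-columns m cs z
mulMV-zero-columns m (c ∷ cs) (true  ∷ z) = begin
  zeros m ⊕ mulMV m (map (λ _ → zeros m) cs) z ≡⟨ cong (zeros m ⊕_) (mulMV-zero-columns m cs z) ⟩
  zeros m ⊕ zeros m                            ≡⟨ zeros-⊕-zeros m ⟩
  zeros m                                      ∎

mulMV-stack : ∀ a b (f g : Word → Word) cs z → All (λ c → length (f c) ≡ a) cs →
  mulMV (a + b) (map (λ c → f c ++ g c) cs) z ≡ mulMV a (map f cs) z ++ mulMV b (map g cs) z
mulMV-stack a b f g []       z           _             = replicate-+ a b false
mulMV-stack a b f g (c ∷ cs) []          _             = replicate-+ a b false
mulMV-stack a b f g (c ∷ cs) (false ∷ z) (_ ∷ hs)      = mulMV-stack a b f g cs z hs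
mulMV-stack a b f g (c ∷ cs) (true  ∷ z) (|fc|≡a ∷ hs) = begin
  (f c ++ g c) ⊕ mulMV (a + b) (map (λ c → f c ++ g c) cs) z
    ≡⟨ cong ((f c ++ g c) ⊕_) (mulMV-stack a b f g cs z hs) ⟩
  (f c ++ g c) ⊕ (mulMV a (map f cs) z ++ mulMV b (map g cs) z)
    ≡⟨ ⊕-++ (f c) (g c) _ _ (trans |fc|≡a (sym (length-mulMV z (map⁺ hs)))) ⟩
  (f c ⊕ mulMV a (map f cs) z) ++ (g c ⊕ mulMV b (map g cs) z) ∎

2^suc≡2^+2^ : ∀ d → 2 ^ suc d ≡ 2 ^ d + 2 ^ d
2^suc≡2^+2^ d = cong (2 ^ d +_) (+-identityʳ (2 ^ d))

<⇒<ᵇ≡true : ∀ {i n} → i < n → (i <ᵇ n) ≡ true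
<⇒<ᵇ≡true {i} {n} i<n with i <ᵇ n | <⇒<ᵇ i<n
... | true | _ = refl

m+n<ᵇm≡false : ∀ m n → (m + n <ᵇ m) ≡ false
m+n<ᵇm≡false zero    n = refl
m+n<ᵇm≡false (suc m) n = m+n<ᵇm≡false m n

Ment-upper-left : ∀ d i j → i < 2 ^ d → j < 2 ^ d → Ment (suc d) i j ≡ Ment d i j
Ment-upper-left d i j i< j< rewrite <⇒<ᵇ≡true i< | <⇒<ᵇ≡true j< = refl

Ment-upper-right : ∀ d i j → i < 2 ^ d → Ment (suc d) i (2 ^ d + j) ≡ Ment d i j
Ment-upper-right d i j i< rewrite <⇒<ᵇ≡true i< | m+n<ᵇm≡false (2 ^ d) j | m+n∸m≡n (2 ^ d) j = refl

Ment-lower-left : ∀ d i j → j < 2 ^ d → Ment (suc d) (2 ^ d + i) j ≡ false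
Ment-lower-left d i j j< rewrite m+n<ᵇm≡false (2 ^ d) i | <⇒<ᵇ≡true j< = refl

Ment-lower-right : ∀ d i j → Ment (suc d) (2 ^ d + i) (2 ^ d + j) ≡ Ment d i j
Ment-lower-right d i j
  rewrite m+n<ᵇm≡false (2 ^ d) i | m+n<ᵇm≡false (2 ^ d) j | m+n∸m≡n (2 ^ d) i | m+n∸m≡n (2 ^ d) j = refl

column : ℕ → ℕ → Word
column d j = applyUpTo (λ i → Ment d i j) (2 ^ d)

columns≡applyUpTo-column : ∀ d → columns d ≡ applyUpTo (column d) (2 ^ d)
columns≡applyUpTo-column d = trans (map-applyUpTo (λ j → j) _ (2 ^ d))
  (applyUpTo-cong< _ _ (2 ^ d) (λ j _ → map-applyUpTo (λ i → i) (λ i → Ment d i j) (2 ^ d)))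

column-suc-left : ∀ d j → j < 2 ^ d → column (suc d) j ≡ column d j ++ zeros (2 ^ d)
column-suc-left d j j< = begin
  applyUpTo (λ i → Ment (suc d) i j) (2 ^ suc d)
    ≡⟨ cong (applyUpTo _) (2^suc≡2^+2^ d) ⟩
  applyUpTo (λ i → Ment (suc d) i j) (2 ^ d + 2 ^ d)
    ≡⟨ applyUpTo-+ _ (2 ^ d) (2 ^ d) ⟩
  applyUpTo (λ i → Ment (suc d) i j) (2 ^ d) ++ applyUpTo (λ i → Ment (suc d) (2 ^ d + i) j) (2 ^ d)
    ≡⟨ cong₂ _++_ (applyUpTo-cong< _ _ (2 ^ d) (λ i i< → Ment-upper-left d i j i< j<))
                  (trans (applyUpTo-cong< _ _ (2 ^ d) (λ i _ → Ment-lower-left d i j j<))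
                         (applyUpTo-const false (2 ^ d))) ⟩
  column d j ++ zeros (2 ^ d) ∎

column-suc-right : ∀ d j → column (suc d) (2 ^ d + j) ≡ column d j ++ column d j
column-suc-right d j = begin
  applyUpTo (λ i → Ment (suc d) i (2 ^ d + j)) (2 ^ suc d)
    ≡⟨ cong (applyUpTo _) (2^suc≡2^+2^ d) ⟩
  applyUpTo (λ i → Ment (suc d) i (2 ^ d + j)) (2 ^ d + 2 ^ d)
    ≡⟨ applyUpTo-+ _ (2 ^ d) (2 ^ d) ⟩
  applyUpTo (λ i → Ment (suc d) i (2 ^ d + j)) (2 ^ d)
    ++ applyUpTo (λ i → Ment (suc d) (2 ^ d + i) (2 ^ d + j)) (2 ^ d)
    ≡⟨ cong₂ _++_ (applyUpTo-cong< _ _ (2 ^ d) (λ i i< → Ment-upper-right d i j i<))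
                  (applyUpTo-cong< _ _ (2 ^ d) (λ i _ → Ment-lower-right d i j)) ⟩
  column d j ++ column d j ∎

columns-suc : ∀ d →
  columns (suc d) ≡ map (λ c → c ++ zeros (2 ^ d)) (columns d) ++ map (λ c → c ++ c) (columns d)
columns-suc d = begin
  columns (suc d)
    ≡⟨ columns≡applyUpTo-column (suc d) ⟩
  applyUpTo (column (suc d)) (2 ^ suc d)
    ≡⟨ cong (applyUpTo _) (2^suc≡2^+2^ d) ⟩
  applyUpTo (column (suc d)) (2 ^ d + 2 ^ d)
    ≡⟨ applyUpTo-+ _ (2 ^ d) (2 ^ d) ⟩
  applyUpTo (column (suc d)) (2 ^ d) ++ applyUpTo (λ j → column (suc d) (2 ^ d + j)) (2 ^ d)
    ≡⟨ cong₂ _++_ (applyUpTo-cong< _ _ (2 ^ d) (column-suc-left d))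
                  (applyUpTo-cong< _ _ (2 ^ d) (λ j _ → column-suc-right d j)) ⟩
  applyUpTo (λ j → column d j ++ zeros (2 ^ d)) (2 ^ d) ++ applyUpTo (λ j → column d j ++ column d j) (2 ^ d)
    ≡⟨ cong₂ _++_ (map-applyUpTo (column d) _ (2 ^ d)) (map-applyUpTo (column d) _ (2 ^ d)) ⟨
  map (λ c → c ++ zeros (2 ^ d)) (applyUpTo (column d) (2 ^ d))
    ++ map (λ c → c ++ c) (applyUpTo (column d) (2 ^ d))
    ≡⟨ cong (λ cs → map (λ c → c ++ zeros (2 ^ d)) cs ++ map (λ c → c ++ c) cs)
            (columns≡applyUpTo-column d) ⟨
  map (λ c → c ++ zeros (2 ^ d)) (columns d) ++ map (λ c → c ++ c) (columns d) ∎

length-columns : ∀ d → length (columns d) ≡ 2 ^ d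
length-columns d = trans (length-map _ (upTo (2 ^ d))) (length-applyUpTo (λ j → j) (2 ^ d))

columns-height : ∀ d → ColumnsOfHeight (2 ^ d) (columns d)
columns-height d = map⁺ (universal |column|≡2^d (upTo (2 ^ d)))
  where
  |column|≡2^d : ∀ j → length (map (λ i → Ment d i j) (upTo (2 ^ d))) ≡ 2 ^ d
  |column|≡2^d j = trans (length-map _ (upTo (2 ^ d))) (length-applyUpTo id (2 ^ d))

mulMV-columns-suc : ∀ d z₁ z₂ → length z₁ ≡ 2 ^ d →
  mulMV (2 ^ d + 2 ^ d) (columns (suc d)) (z₁ ++ z₂)
    ≡ (mulMV (2 ^ d) (columns d) z₁ ⊕ mulMV (2 ^ d) (columns d) z₂) ++ mulMV (2 ^ d) (columns d) z₂
mulMV-columns-suc d z₁ z₂ |z₁|≡n = begin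
  mulMV (n + n) (columns (suc d)) (z₁ ++ z₂)
    ≡⟨ cong (λ cs → mulMV (n + n) cs (z₁ ++ z₂)) (columns-suc d) ⟩
  mulMV (n + n) (map pad C ++ map double C) (z₁ ++ z₂)
    ≡⟨ mulMV-++ (n + n) (map pad C) (map double C) z₁ z₂
                (trans (length-map pad C) (trans (length-columns d) (sym |z₁|≡n))) ⟩
  mulMV (n + n) (map pad C) z₁ ⊕ mulMV (n + n) (map double C) z₂
    ≡⟨ cong₂ _⊕_ (mulMV-stack n n id (λ _ → zeros n) C z₁ height) (mulMV-stack n n id id C z₂ height) ⟩
  (mulMV n (map id C) z₁ ++ mulMV n (map (λ _ → zeros n) C) z₁)
    ⊕ (mulMV n (map id C) z₂ ++ mulMV n (map id C) z₂)
    ≡⟨ cong₂ (λ cs zs → (mulMV n cs z₁ ++ zs) ⊕ (mulMV n cs z₂ ++ mulMV n cs z₂))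
             (map-id C) (mulMV-zero-columns n C z₁) ⟩
  (M z₁ ++ zeros n) ⊕ (M z₂ ++ M z₂)
    ≡⟨ ⊕-++ (M z₁) (zeros n) (M z₂) (M z₂) (trans (length-mulMV z₁ height) (sym (length-mulMV z₂ height))) ⟩
  (M z₁ ⊕ M z₂) ++ (zeros n ⊕ M z₂)
    ≡⟨ cong ((M z₁ ⊕ M z₂) ++_) (zeros-⊕ n (M z₂) (length-mulMV≤ n C z₂)) ⟩
  (M z₁ ⊕ M z₂) ++ M z₂ ∎
  where
  n = 2 ^ d
  C = columns d
  M = mulMV n C
  height : ColumnsOfHeight n C
  height = columns-height d
  pad double : Word → Word
  pad c = c ++ zeros n
  double c = c ++ c

columns-surjective : ∀ d w → length w ≡ 2 ^ d →
  ∃ λ z → length z ≡ 2 ^ d × mulMV (2 ^ d) (columns d) z ≡ w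
columns-surjective zero    (false ∷ []) _ = false ∷ [] , refl , refl
columns-surjective zero    (true  ∷ []) _ = true ∷ [] , refl , refl
columns-surjective (suc d) w |w|≡2^suc
  with halves (2 ^ d) w (trans |w|≡2^suc (2^suc≡2^+2^ d))
... | w₁ , w₂ , |w₁|≡n , |w₂|≡n , refl
  with columns-surjective d w₂ |w₂|≡n | columns-surjective d (w₁ ⊕ w₂) (length-⊕-≡ w₁ w₂ |w₁|≡n |w₂|≡n)
... | z₂ , |z₂|≡n , Mz₂≡w₂ | z₁ , |z₁|≡n , Mz₁≡w₁⊕w₂ =
  z₁ ++ z₂ ,
  trans (length-++ z₁) (trans (cong₂ _+_ |z₁|≡n |z₂|≡n) (sym (2^suc≡2^+2^ d))) ,
  subst (λ k → mulMV k (columns (suc d)) (z₁ ++ z₂) ≡ w₁ ++ w₂) (sym (2^suc≡2^+2^ d)) (begin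
    mulMV (n + n) (columns (suc d)) (z₁ ++ z₂) ≡⟨ mulMV-columns-suc d z₁ z₂ |z₁|≡n ⟩
    (M z₁ ⊕ M z₂) ++ M z₂                     ≡⟨ cong₂ (λ x y → (x ⊕ y) ++ y) Mz₁≡w₁⊕w₂ Mz₂≡w₂ ⟩
    ((w₁ ⊕ w₂) ⊕ w₂) ++ w₂                    ≡⟨ cong (_++ w₂) (⊕-cancelʳ w₁ w₂ (≤-reflexive |w₁|≡|w₂|)) ⟩
    w₁ ++ w₂                                  ∎)
  where
  n = 2 ^ d
  M = mulMV n (columns d)
  |w₁|≡|w₂| : length w₁ ≡ length w₂
  |w₁|≡|w₂| = trans |w₁|≡n (sym |w₂|≡n)

columns-end-with-ones : ∀ d → ∃ λ cs → columns d ≡ cs ++ ones (2 ^ d) ∷ []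
columns-end-with-ones zero = [] , refl
columns-end-with-ones (suc d) with columns-end-with-ones d
... | cs , columns≡cs++ones = map pad (columns d) ++ map double cs , (begin
  columns (suc d)
    ≡⟨ columns-suc d ⟩
  map pad (columns d) ++ map double (columns d)
    ≡⟨ cong (λ cs′ → map pad (columns d) ++ map double cs′) columns≡cs++ones ⟩
  map pad (columns d) ++ map double (cs ++ ones n ∷ [])
    ≡⟨ cong (map pad (columns d) ++_) (map-++ double cs (ones n ∷ [])) ⟩
  map pad (columns d) ++ (map double cs ++ (ones n ++ ones n) ∷ [])
    ≡⟨ ++-assoc (map pad (columns d)) (map double cs) _ ⟨
  (map pad (columns d) ++ map double cs) ++ (ones n ++ ones n) ∷ []
    ≡⟨ cong (λ o → (map pad (columns d) ++ map double cs) ++ o ∷ [])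
            (trans (sym (replicate-+ n n true)) (cong ones (sym (2^suc≡2^+2^ d)))) ⟩
  (map pad (columns d) ++ map double cs) ++ ones (2 ^ suc d) ∷ [] ∎)
  where
  n = 2 ^ d
  pad double : Word → Word
  pad c = c ++ zeros n
  double c = c ++ c

zipWith-σ^-zeros : ∀ cs → zipWith σ^ (replicate (length cs) 0) cs ≡ cs
zipWith-σ^-zeros []       = refl
zipWith-σ^-zeros (c ∷ cs) = cong (c ∷_) (zipWith-σ^-zeros cs)

Mshift-zeros : ∀ d → Mshift d (replicate (2 ^ d) 0) ≡ columns d
Mshift-zeros d = trans (cong (λ n → zipWith σ^ (replicate n 0) (columns d)) (sym (length-columns d)))
  (zipWith-σ^-zeros (columns d))

admissible-zeros : ∀ {m} → 0 < m → Admissible (replicate m 0)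
admissible-zeros {suc zero}    _ = refl
admissible-zeros {suc (suc m)} _ = (z≤n , z≤n) , admissible-zeros {suc m} (s≤s z≤n)

allWords-suc : ∀ k → ∃ λ rest → allWords (suc k) ≡ zeros (suc k) ∷ (zeros k ++ true ∷ []) ∷ rest
allWords-suc zero = [] , refl
allWords-suc (suc k) with allWords-suc k
... | rest , allWords≡ = map (false ∷_) rest ++ map (true ∷_) (allWords (suc k)) ,
  cong (λ ws → map (false ∷_) ws ++ map (true ∷_) (allWords (suc k))) allWords≡

affine-pair≡complementary-halves : ∀ {m} cols z → ColumnsOfHeight m cols → length cols ≡ m →
  (∃ λ cs → cols ≡ cs ++ ones m ∷ []) → length z ≡ m →
  concatMap (λ u → mulMV m cols (u ⊕ z)) (take 2 (allWords m))
    ≡ mulMV m cols z ++ (mulMV m cols z ⊕ ones m)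
affine-pair≡complementary-halves {zero} _ _ _ |cols|≡0 (cs , refl) _ =
  ⊥-elim (1+n≢0 (trans (sym (length-∷ʳ cs _)) |cols|≡0))
affine-pair≡complementary-halves {suc k} cols z height |cols|≡m (cs , refl) |z|≡m
  rewrite proj₂ (allWords-suc k) = cong₂ _++_ first (trans (++-identityʳ _) second)
  where
  m = suc k
  e = zeros k ++ true ∷ []
  |e|≡m : length e ≡ m
  |e|≡m = trans (length-∷ʳ (zeros k) true) (cong suc (length-replicate k))
  first : mulMV m cols (zeros m ⊕ z) ≡ mulMV m cols z
  first = cong (mulMV m cols) (zeros-⊕ m z (≤-reflexive |z|≡m))
  second : mulMV m cols (e ⊕ z) ≡ mulMV m cols z ⊕ ones m
  second = begin
    mulMV m cols (e ⊕ z)             ≡⟨ cong (mulMV m cols) (⊕-comm e z) ⟩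
    mulMV m cols (z ⊕ e)             ≡⟨ mulMV-⊕ cols z e height (trans |z|≡m (sym |e|≡m)) ⟩
    mulMV m cols z ⊕ mulMV m cols e  ≡⟨ cong (mulMV m cols z ⊕_) (mulMV-last-unit cs (ones m)
                                          (suc-injective (trans (sym (length-∷ʳ cs _)) |cols|≡m))
                                          (≤-reflexive (length-replicate m))) ⟩
    mulMV m cols z ⊕ ones m          ∎

image-complementary-halves-affine : ∀ d z → length z ≡ 2 ^ d →
  AffineNecklace d 1 (mulMV (2 ^ d) (columns d) z ++ (mulMV (2 ^ d) (columns d) z ⊕ ones (2 ^ d)))
image-complementary-halves-affine d z |z|≡2^d =
  replicate n 0 , length-replicate n , admissible-zeros (m^n>0 2 d) , z , |z|≡2^d , sym (begin
    concatMap (λ u → mulMV n (Mshift d (replicate n 0)) (u ⊕ z)) (take 2 (allWords n))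
      ≡⟨ cong (λ cols → concatMap (λ u → mulMV n cols (u ⊕ z)) (take 2 (allWords n))) (Mshift-zeros d) ⟩
    concatMap (λ u → mulMV n (columns d) (u ⊕ z)) (take 2 (allWords n))
      ≡⟨ affine-pair≡complementary-halves (columns d) z (columns-height d) (length-columns d)
                                          (columns-end-with-ones d) |z|≡2^d ⟩
    mulMV n (columns d) z ++ (mulMV n (columns d) z ⊕ ones n) ∎)
  where
  n = 2 ^ d

complementary-halves-affine : ∀ d w → length w ≡ 2 ^ d →
  AffineNecklace d 1 (w ++ (w ⊕ ones (2 ^ d)))
complementary-halves-affine d w |w|≡2^d with columns-surjective d w |w|≡2^d
... | z , |z|≡2^d , refl = image-complementary-halves-affine d z |z|≡2^d

lemma8 : (d : ℕ) →
    ((v : List Bool) →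
       NestedPerfectNecklace1 (2 ^ d) v ⇔
       (∃ λ (w : List Bool) → ∃ λ (w' : List Bool) →
          length w ≡ 2 ^ d × length w' ≡ 2 ^ d × w' ≡ w ⊕ ones (2 ^ d) × v ≡ w ++ w'))
    × ((v : List Bool) → NestedPerfectNecklace1 (2 ^ d) v → AffineNecklace d 1 v)
lemma8 d = perfect⇔complementary-halves , affine
  where
  affine : ∀ v → NestedPerfectNecklace1 (2 ^ d) v → AffineNecklace d 1 v
  affine v P with perfect⇒complementary-halves v P
  ... | w , |w|≡2^d , refl = complementary-halves-affine d w |w|≡2^d
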